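{- Let $\pi=\pi_1\cdots\pi_n$ be a permutation of $\{1,\dots,n\}$ in one-line notation, and let $N(\pi)$ be the set of directed edges produced by the following procedure. (D1) If the last entry of the current permutation (of length $m$) equals $m$, the point $m$ is neutral, and one continues with the permutation obtained by deleting the last entry. (D2) If the last entry $\pi_m$ of the current permutation is not $m$, let $j$ be the smallest index with $\pi_j>\pi_m$; record the edge $(j,m)$ and replace the current permutation by the one obtained by exchanging the entries in positions $j$ and $m$; repeat (D2) until the last entry equals $m$, then apply (D1). The procedure stops when the current permutation is the identity. Then $N(\pi)$ is a network in $\mathcal{N}(n)$.
   Context: A network on $n$ points is a set $E$ of ordered pairs $(i,j)$ of integers with $1\le i<j\le n$ (directed edges) such that there is no triple $i<j<k$ with $(i,j),(j,k)\in E$ (so every point is a source, a sink, or neutral, never both a source and a sink). $\mathcal{N}(n)$ denotes the set of networks on $n$ points satisfying condition (B1): whenever $(i,k),(j,l)\in E$ with $i<j<k<l$, also $(j,k)\in E$. -}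

module Defs where

open import Data.Nat using (ℕ; zero; suc; _<_; _≤_; _<ᵇ_; _≡ᵇ_)
open import Data.Bool using (true; false)
open import Data.Fin using (Fin; toℕ)
open import Data.Fin.Permutation using (Permutation′; _⟨$⟩ʳ_)
open import Data.List using (List; []; _∷_; _++_; length; map; tabulate)
open import Data.List.Membership.Propositional using (_∈_)
open import Data.Maybe using (Maybe; just; nothing)
open import Data.Product using (_×_; _,_)
open import Relation.Nullary using (¬_)

-- Networks.  An edge (i , j) is an ordered pair of naturals; points are
-- 1,…,n.  A set of edges is represented by a list (membership via _∈_).

Edge : Set
Edge = ℕ × ℕ

record IsNetwork (n : ℕ) (E : List Edge) : Set where
  field
    edges-ok : ∀ i j → (i , j) ∈ E → (1 ≤ i) × (i < j) × (j ≤ n)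
    no-path  : ∀ i j k → i < j → j < k → ¬ (((i , j) ∈ E) × ((j , k) ∈ E))

B1 : List Edge → Set
B1 E = ∀ i j k l → i < j → j < k → k < l →
       (i , k) ∈ E → (j , l) ∈ E → (j , k) ∈ E

record InNet (n : ℕ) (E : List Edge) : Set where
  field
    network : IsNetwork n E
    b1      : B1 E

-- The procedure (D1)/(D2).  A permutation in one-line notation is a list
-- of values π₁ ⋯ π_m (values in 1..m), positions are 1-indexed.

unsnoc : List ℕ → Maybe (List ℕ × ℕ)
unsnoc [] = nothing
unsnoc (x ∷ xs) with unsnoc xs
... | nothing = just ([] , x)
... | just (ys , y) = just (x ∷ ys , y)

findGreater : ℕ → ℕ → List ℕ → Maybe (ℕ × ℕ × List ℕ)
findGreater x p [] = nothing
findGreater x p (y ∷ ys) with x <ᵇ y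
... | true = just (p , y , x ∷ ys)
... | false with findGreater x (suc p) ys
...   | nothing = nothing
...   | just (j , z , zs) = just (j , z , y ∷ zs)

-- Repeated (D2) on the current permutation  xs ++ [x]  of length m.  The fuel argument is only for
-- termination: the last entry strictly increases at each step, so at
-- most m steps occur and fuel m always suffices.
d2 : ℕ → ℕ → List ℕ → ℕ → List ℕ × List Edge
d2 fuel m xs x with x ≡ᵇ m
... | true = (xs , [])
... | false with fuel
...   | zero = (xs , [])
...   | suc f with findGreater x 1 xs
...     | nothing = (xs , [])
...     | just (j , y , xs′) with d2 f m xs′ y
...       | (r , es) = (r , (j , m) ∷ es)

run : ℕ → List ℕ → List Edge
run zero l = []
run (suc f) l with unsnoc l
... | nothing = []
... | just (xs , x) with d2 (length l) (length l) xs x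
...   | (r , es) = es ++ run f r

oneLine : ∀ {n} → Permutation′ n → List ℕ
oneLine π = tabulate (λ i → suc (toℕ (π ⟨$⟩ʳ i)))

Nπ : ∀ n → Permutation′ n → List Edge
Nπ n π = run n (oneLine π)

{-# OPTIONS --safe #-}
-- Round m of the procedure, acting on π₁ ⋯ π_m, records the edge (j , m) for exactly
-- those left-to-right maxima j of π₁ ⋯ π_{m-1} whose value exceeds π_m, and its swaps
-- keep every left-to-right maximum of π₁ ⋯ π_{m-1} a left-to-right maximum of the
-- permutation passed on to the later rounds. Hence a left-to-right maximum j of the
-- current permutation is never the target of a later edge, and a later edge (i , k)
-- with i < j < k comes with (j , k), since the value at j exceeds the value at i.
-- Applied to the sources of round m, this excludes paths i → j → m and gives (B1).
module Submission where

open import Defs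
open import Data.Nat using (ℕ; zero; suc; z<s; _+_; _∸_; _⊔_; _≤_; _<_; z≤n; s≤s; _<ᵇ_; _≡ᵇ_)
open import Data.Nat.Properties
open import Data.Bool using (true; false)
open import Data.Unit using (tt)
open import Data.Product using (_×_; _,_; proj₁; proj₂; ∃-syntax)
open import Data.Sum using (_⊎_; inj₁; inj₂)
open import Data.Maybe using (just; nothing)
open import Data.Fin.Properties using (toℕ-injective; toℕ<n)
open import Data.Fin.Permutation using (Permutation′; _⟨$⟩ʳ_)
open import Function.Bundles using (Injection)
open import Function.Properties.Inverse using (↔⇒↣)
open import Data.List using (List; []; _∷_; _++_; _∷ʳ_; length; initLast; _∷ʳ′_)
open import Data.List.Properties using (length-tabulate)
open import Data.List.Membership.Propositional using (_∈_; _∉_)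
open import Data.List.Membership.Propositional.Properties using (∈-++⁻; ∈-++⁺ˡ; ∈-++⁺ʳ)
open import Data.List.Relation.Unary.Any using (here; there)
open import Data.List.Relation.Unary.All as All using (All; []; _∷_)
import Data.List.Relation.Unary.All.Properties as All
open import Data.List.Relation.Unary.Unique.Propositional using (Unique)
open import Data.List.Relation.Unary.AllPairs using (_∷_)
import Data.List.Relation.Unary.Unique.Propositional.Properties as Unique
open import Data.List.Relation.Binary.Permutation.Propositional
  using (_↭_; ↭-refl; ↭-sym; ↭-trans; ↭-prep; ↭-swap; ↭⇒↭ₛ)
open import Data.List.Relation.Binary.Permutation.Propositional.Properties
  using (All-resp-↭; ↭-length; ∷↭∷ʳ)
import Data.List.Relation.Binary.Permutation.Setoid.Properties as ↭ₛ
open import Relation.Binary.PropositionalEquality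
open import Relation.Nullary using (¬_; contradiction)
open import Relation.Nullary.Reflects using (ofʸ; ofⁿ)
open import Function using (_∘_)

private
  variable
    b c m n p f i j k x y z : ℕ
    xs xs′ ys zs zs′ r l : List ℕ
    es E : List Edge

Unique-resp-↭ : xs ↭ ys → Unique xs → Unique ys
Unique-resp-↭ xs↭ys = ↭ₛ.Unique-resp-↭ (setoid ℕ) (↭⇒↭ₛ xs↭ys)

-- LRMax b p xs j : the entry at position j of xs, positions being numbered
-- from p, is at least b and exceeds every earlier entry.
data LRMax : ℕ → ℕ → List ℕ → ℕ → Set where
  this   : b ≤ z → LRMax b p (z ∷ zs) p
  beyond : LRMax (b ⊔ suc z) (suc p) zs j → LRMax b p (z ∷ zs) j

LRMax-weaken : c ≤ b → LRMax b p xs j → LRMax c p xs j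
LRMax-weaken c≤b (this b≤z)  = this (≤-trans c≤b b≤z)
LRMax-weaken c≤b (beyond lr) = beyond (LRMax-weaken (⊔-monoˡ-≤ _ c≤b) lr)

LRMax-position : LRMax b p xs j → p ≤ j × j < p + length xs
LRMax-position {p = p} {xs = _ ∷ zs} (this _) = ≤-refl , m<m+n p z<s
LRMax-position {p = p} {xs = _ ∷ zs} {j} (beyond lr) with LRMax-position lr
... | p<j , j<1+p+zs = <⇒≤ p<j , subst (j <_) (sym (+-suc p (length zs))) j<1+p+zs

LRMax-trans : LRMax b p xs i → LRMax c p xs j → i < j → LRMax b p xs j
LRMax-trans (this _)     (this _)     i<j = contradiction i<j (<-irrefl refl)
LRMax-trans (this b≤z)   (beyond lr)  _   =
  beyond (LRMax-weaken (≤-trans (≤-reflexive (m≤n⇒m⊔n≡n (m≤n⇒m≤1+n b≤z))) (m≤n⊔m _ _)) lr)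
LRMax-trans (beyond lr)  (this _)     i<j = contradiction i<j (<-asym (proj₁ (LRMax-position lr)))
LRMax-trans (beyond lr)  (beyond lr′) i<j = beyond (LRMax-trans lr lr′ i<j)

¬LRMax-below : All (_< b) xs → ¬ LRMax b p xs j
¬LRMax-below (z<b ∷ _)   (this b≤z)  = <⇒≱ z<b b≤z
¬LRMax-below (_ ∷ zs<b)  (beyond lr) =
  ¬LRMax-below (All.map (λ w<b → <-≤-trans w<b (m≤m⊔n _ _)) zs<b) lr

LRMax-∷ʳ⁻ : LRMax b p (xs ∷ʳ x) j →
            LRMax b p xs j ⊎ (j ≡ p + length xs × b ≤ x × All (_< x) xs)
LRMax-∷ʳ⁻ {p = p} {xs = []} (this b≤x)     = inj₂ (sym (+-identityʳ p) , b≤x , [])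
LRMax-∷ʳ⁻ {xs = z ∷ zs} (this b≤z)         = inj₁ (this b≤z)
LRMax-∷ʳ⁻ {p = p} {xs = z ∷ zs} (beyond lr) with LRMax-∷ʳ⁻ lr
... | inj₁ lr′                  = inj₁ (beyond lr′)
... | inj₂ (j≡ , b⊔1+z≤x , zs<x) =
  inj₂ (trans j≡ (sym (+-suc p (length zs))) ,
        m⊔n≤o⇒m≤o _ _ b⊔1+z≤x , m⊔n≤o⇒n≤o _ _ b⊔1+z≤x ∷ zs<x)

data FirstGreater (x : ℕ) : ℕ → List ℕ → ℕ → ℕ → List ℕ → Set where
  found : x < y → FirstGreater x p (y ∷ ys) p y (x ∷ ys)
  skip  : z ≤ x → FirstGreater x (suc p) zs j y zs′ → FirstGreater x p (z ∷ zs) j y (z ∷ zs′)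

findGreater-nothing : findGreater x p xs ≡ nothing → All (_≤ x) xs
findGreater-nothing {xs = []} _ = []
findGreater-nothing {x} {p} {z ∷ zs} eq with x <ᵇ z | <ᵇ-reflects-< x z
... | false | ofⁿ x≮z with findGreater x (suc p) zs in eq′
...   | nothing = ≮⇒≥ x≮z ∷ findGreater-nothing eq′

findGreater-just : findGreater x p xs ≡ just (j , y , xs′) → FirstGreater x p xs j y xs′
findGreater-just {x} {p} {z ∷ zs} eq with x <ᵇ z | <ᵇ-reflects-< x z
findGreater-just refl | true | ofʸ x<z = found x<z
... | false | ofⁿ x≮z with findGreater x (suc p) zs in eq′
findGreater-just refl | false | ofⁿ x≮z | just _ = skip (≮⇒≥ x≮z) (findGreater-just eq′)

FirstGreater-< : FirstGreater x p xs j y xs′ → x < y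
FirstGreater-< (found x<y)  = x<y
FirstGreater-< (skip _ fg)  = FirstGreater-< fg

FirstGreater-↭ : FirstGreater x p xs j y xs′ → x ∷ xs ↭ y ∷ xs′
FirstGreater-↭ (found _) = ↭-swap _ _ ↭-refl
FirstGreater-↭ (skip _ fg) =
  ↭-trans (↭-swap _ _ ↭-refl) (↭-trans (↭-prep _ (FirstGreater-↭ fg)) (↭-swap _ _ ↭-refl))

FirstGreater-LRMax : FirstGreater x p xs j y xs′ → LRMax (suc x) p xs j
FirstGreater-LRMax (found x<y)   = this x<y
FirstGreater-LRMax (skip z≤x fg) =
  beyond (LRMax-weaken (⊔-lub ≤-refl (s≤s z≤x)) (FirstGreater-LRMax fg))

FirstGreater-LRMax⁻ : FirstGreater x p xs j y xs′ → LRMax (suc y) p xs′ i → LRMax (suc x) p xs i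
FirstGreater-LRMax⁻ (found x<y)   (this y<x)  = contradiction x<y (<-asym y<x)
FirstGreater-LRMax⁻ {x = x} {y = y} (found _) (beyond lr) =
  beyond (LRMax-weaken (≤-reflexive (⊔-comm (suc x) (suc y))) lr)
FirstGreater-LRMax⁻ (skip z≤x fg) (this y<z)  =
  contradiction (FirstGreater-< fg) (<-asym (<-≤-trans y<z z≤x))
FirstGreater-LRMax⁻ {xs = z ∷ _} {y = y} (skip z≤x fg) (beyond lr) =
  beyond (LRMax-weaken (⊔-lub ≤-refl (s≤s z≤x))
           (FirstGreater-LRMax⁻ fg (LRMax-weaken (m≤m⊔n (suc y) (suc z)) lr)))

FirstGreater-LRMax⁺ : FirstGreater x p xs j y xs′ → LRMax (suc x) p xs i →
                      i ≡ j ⊎ LRMax (suc y) p xs′ i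
FirstGreater-LRMax⁺ (found _) (this _) = inj₁ refl
FirstGreater-LRMax⁺ {x = x} {y = y} (found _) (beyond lr) =
  inj₂ (beyond (LRMax-weaken (≤-reflexive (⊔-comm (suc y) (suc x))) lr))
FirstGreater-LRMax⁺ (skip z≤x _) (this x<z) = contradiction z≤x (<⇒≱ x<z)
FirstGreater-LRMax⁺ {x = x} {xs = z ∷ _} (skip z≤x fg) (beyond lr)
  with FirstGreater-LRMax⁺ fg (LRMax-weaken (m≤m⊔n (suc x) (suc z)) lr)
... | inj₁ i≡j = inj₁ i≡j
... | inj₂ lr′ =
  inj₂ (beyond (LRMax-weaken (⊔-lub ≤-refl (s≤s (≤-trans z≤x (<⇒≤ (FirstGreater-< fg))))) lr′))

FirstGreater-preserves-LRMax : b ≤ x → x ∉ xs → FirstGreater x p xs j y xs′ →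
                               LRMax b p xs i → LRMax b p xs′ i
FirstGreater-preserves-LRMax b≤x _ (found _)   (this _)    = this b≤x
FirstGreater-preserves-LRMax b≤x _ (found x<y) (beyond lr) =
  beyond (LRMax-weaken (⊔-monoʳ-≤ _ (s≤s (<⇒≤ x<y))) lr)
FirstGreater-preserves-LRMax _ _ (skip _ _) (this b≤z) = this b≤z
FirstGreater-preserves-LRMax b≤x x∉z∷zs (skip z≤x fg) (beyond lr) =
  beyond (FirstGreater-preserves-LRMax (⊔-lub b≤x z<x) (x∉z∷zs ∘ there) fg lr)
  where
  z<x = ≤∧≢⇒< z≤x (λ z≡x → x∉z∷zs (here (sym z≡x)))

data Swaps (m : ℕ) : List ℕ → ℕ → List ℕ → List Edge → Set where
  done : All (_≤ x) xs → Swaps m xs x xs []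
  step : FirstGreater x 1 xs j y xs′ → Swaps m xs′ y r es → Swaps m xs x r ((j , m) ∷ es)

-- Each swap strictly increases the last entry, which stays ≤ m, so at most m ∸ x swaps remain.
d2-Swaps : ∀ fuel m xs x → x ≤ m → All (_≤ m) xs → m ∸ x ≤ fuel →
           Swaps m xs x (proj₁ (d2 fuel m xs x)) (proj₂ (d2 fuel m xs x))
d2-Swaps fuel m xs x x≤m xs≤m gap with x ≡ᵇ m | ≡ᵇ⇒≡ x m
... | true | x≡m = done (subst (λ v → All (_≤ v) xs) (sym (x≡m tt)) xs≤m)
d2-Swaps zero m xs x x≤m xs≤m gap | false | _
  rewrite ≤-antisym x≤m (m∸n≡0⇒m≤n (n≤0⇒n≡0 gap)) = done xs≤m
d2-Swaps (suc fuel) m xs x x≤m xs≤m gap | false | _ with findGreater x 1 xs in eq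
... | nothing = done (findGreater-nothing eq)
... | just (j , y , xs′) = step fg (d2-Swaps fuel m xs′ y (All.head bounds) (All.tail bounds) gap′)
  where
  fg : FirstGreater x 1 xs j y xs′
  fg = findGreater-just eq
  bounds : All (_≤ m) (y ∷ xs′)
  bounds = All-resp-↭ (FirstGreater-↭ fg) (x≤m ∷ xs≤m)
  gap′ : m ∸ y ≤ fuel
  gap′ = ≤-pred (<-≤-trans (∸-monoʳ-< (FirstGreater-< fg) (All.head bounds)) gap)

Swaps-sound : Swaps m xs x r es → (i , k) ∈ es → k ≡ m × LRMax (suc x) 1 xs i
Swaps-sound (step fg _) (here refl) = refl , FirstGreater-LRMax fg
Swaps-sound (step fg sw) (there e∈es) with Swaps-sound sw e∈es
... | k≡m , lr = k≡m , FirstGreater-LRMax⁻ fg lr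

Swaps-complete : Swaps m xs x r es → LRMax (suc x) 1 xs i → (i , m) ∈ es
Swaps-complete (done xs≤x) lr = contradiction lr (¬LRMax-below (All.map s≤s xs≤x))
Swaps-complete (step fg sw) lr with FirstGreater-LRMax⁺ fg lr
... | inj₁ refl = here refl
... | inj₂ lr′  = there (Swaps-complete sw lr′)

Swaps-preserves-LRMax : b ≤ x → Unique (x ∷ xs) → Swaps m xs x r es →
                        LRMax b 1 xs i → LRMax b 1 r i
Swaps-preserves-LRMax _   _ (done _)     lr = lr
Swaps-preserves-LRMax b≤x u (step fg sw) lr =
  Swaps-preserves-LRMax (≤-trans b≤x (<⇒≤ (FirstGreater-< fg))) (Unique-resp-↭ (FirstGreater-↭ fg) u) sw
    (FirstGreater-preserves-LRMax b≤x (Unique.Unique[x∷xs]⇒x∉xs u) fg lr)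

Swaps-↭ : Swaps m xs x r es → ∃[ z ] (x ∷ xs ↭ z ∷ r × All (_≤ z) r)
Swaps-↭ (done xs≤x) = _ , ↭-refl , xs≤x
Swaps-↭ (step fg sw) with Swaps-↭ sw
... | z , ↭z∷r , r≤z = z , ↭-trans (FirstGreater-↭ fg) ↭z∷r , r≤z

Swaps-length : Swaps m xs x r es → length r ≡ length xs
Swaps-length sw with Swaps-↭ sw
... | _ , ↭z∷r , _ = suc-injective (sym (↭-length ↭z∷r))

Swaps-unique-below : Unique (x ∷ xs) → All (_≤ m) (x ∷ xs) → Swaps m xs x r es →
                     Unique r × All (_< m) r
Swaps-unique-below u bounded sw with Swaps-↭ sw
... | z , ↭z∷r , r≤z with Unique-resp-↭ ↭z∷r u | All-resp-↭ ↭z∷r bounded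
...   | z∉r ∷ r-unique | z≤m ∷ _ =
  r-unique , All.zipWith (λ (w≤z , z≢w) → <-≤-trans (≤∧≢⇒< w≤z (z≢w ∘ sym)) z≤m) (r≤z , z∉r)

Swaps-source-LRMax : Unique (x ∷ xs) → Swaps m xs x r es → (j , k) ∈ es → LRMax 0 1 r j
Swaps-source-LRMax u sw e∈es =
  Swaps-preserves-LRMax z≤n u sw (LRMax-weaken z≤n (proj₂ (Swaps-sound sw e∈es)))

unsnoc-∷ʳ : ∀ xs x → unsnoc (xs ∷ʳ x) ≡ just (xs , x)
unsnoc-∷ʳ []       x = refl
unsnoc-∷ʳ (z ∷ zs) x rewrite unsnoc-∷ʳ zs x = refl

data Rounds : ℕ → List ℕ → List Edge → Set where
  empty : Rounds 0 [] []
  round : Unique (x ∷ xs) → Swaps (suc f) xs x r es → Rounds f r E →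
          Rounds (suc f) (xs ∷ʳ x) (es ++ E)

rounds : ∀ f l → length l ≡ f → Unique l → All (_≤ f) l → Rounds f l (run f l)
rounds zero    []      _ _ _ = empty
rounds zero    (_ ∷ _) () _ _
rounds (suc f) l len u l≤f with initLast l
... | [] = contradiction len λ ()
... | xs ∷ʳ′ x rewrite unsnoc-∷ʳ xs x | len =
  round x∷xs-unique sw (later-rounds (Swaps-unique-below x∷xs-unique x∷xs-bounded sw) (Swaps-length sw))
  where
  x∷xs↭l : x ∷ xs ↭ xs ∷ʳ x
  x∷xs↭l = ∷↭∷ʳ x xs
  xs-length : length xs ≡ f
  xs-length = suc-injective (trans (↭-length x∷xs↭l) len)
  x∷xs-unique : Unique (x ∷ xs)
  x∷xs-unique = Unique-resp-↭ (↭-sym x∷xs↭l) u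
  x∷xs-bounded : All (_≤ suc f) (x ∷ xs)
  x∷xs-bounded = All-resp-↭ (↭-sym x∷xs↭l) l≤f
  later-rounds : Unique r × All (_< suc f) r → length r ≡ length xs → Rounds f r (run f r)
  later-rounds (r-unique , r<m) r-length =
    rounds f _ (trans r-length xs-length) r-unique (All.map ≤-pred r<m)
  sw : Swaps (suc f) xs x (proj₁ (d2 (suc f) (suc f) xs x)) (proj₂ (d2 (suc f) (suc f) xs x))
  sw = d2-Swaps (suc f) (suc f) xs x
         (All.head x∷xs-bounded) (All.tail x∷xs-bounded) (m∸n≤m (suc f) x)

Rounds-length : Rounds f l E → length l ≡ f
Rounds-length empty = refl
Rounds-length (round {x = x} {xs = xs} _ sw rs) =
  trans (sym (↭-length (∷↭∷ʳ x xs))) (cong suc (trans (sym (Swaps-length sw)) (Rounds-length rs)))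

round-length : Swaps m xs x r es → Rounds f r E → length xs ≡ f
round-length sw rs = trans (sym (Swaps-length sw)) (Rounds-length rs)

Rounds-edge-bounds : Rounds f l E → (i , k) ∈ E → 1 ≤ i × i < k × k ≤ f
Rounds-edge-bounds (round {es = es} _ sw rs) e∈ with ∈-++⁻ es e∈
... | inj₂ e∈E with 1≤i , i<k , k≤f ← Rounds-edge-bounds rs e∈E = 1≤i , i<k , m≤n⇒m≤1+n k≤f
... | inj₁ e∈es
  with refl , lr ← Swaps-sound sw e∈es | refl ← round-length sw rs =
  let 1≤i , i<k = LRMax-position lr in 1≤i , i<k , ≤-refl

Rounds-target-≤ : Rounds f l E → (i , k) ∈ E → k ≤ f
Rounds-target-≤ rs e∈E = proj₂ (proj₂ (Rounds-edge-bounds rs e∈E))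

Rounds-LRMax-not-target : Rounds f l E → LRMax 0 1 l j → (i , j) ∉ E
Rounds-LRMax-not-target (round {es = es} u sw rs) lr e∈
  with refl ← round-length sw rs | LRMax-∷ʳ⁻ lr | ∈-++⁻ es e∈
... | inj₁ lr′ | inj₁ e∈es with refl , _ ← Swaps-sound sw e∈es =
  <-irrefl refl (proj₂ (LRMax-position lr′))
... | inj₁ lr′ | inj₂ e∈E = Rounds-LRMax-not-target rs (Swaps-preserves-LRMax z≤n u sw lr′) e∈E
... | inj₂ (_ , _ , xs<x) | inj₁ e∈es =
  ¬LRMax-below (All.map m<n⇒m<1+n xs<x) (proj₂ (Swaps-sound sw e∈es))
... | inj₂ (refl , _) | inj₂ e∈E = 1+n≰n (Rounds-target-≤ rs e∈E)

Rounds-LRMax-B1 : Rounds f l E → LRMax 0 1 l j → (i , k) ∈ E → i < j → j < k → (j , k) ∈ E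
Rounds-LRMax-B1 (round {es = es} u sw rs) lr e∈ i<j j<k
  with refl ← round-length sw rs | LRMax-∷ʳ⁻ lr | ∈-++⁻ es e∈
... | inj₁ lr′ | inj₁ e∈es with refl , li ← Swaps-sound sw e∈es =
  ∈-++⁺ˡ (Swaps-complete sw (LRMax-trans li lr′ i<j))
... | inj₁ lr′ | inj₂ e∈E =
  ∈-++⁺ʳ es (Rounds-LRMax-B1 rs (Swaps-preserves-LRMax z≤n u sw lr′) e∈E i<j j<k)
... | inj₂ (refl , _) | inj₁ e∈es with refl , _ ← Swaps-sound sw e∈es =
  contradiction j<k (<-irrefl refl)
... | inj₂ (refl , _) | inj₂ e∈E =
  contradiction (Rounds-target-≤ rs e∈E) (<⇒≱ (<-trans (n<1+n _) j<k))

Rounds-no-path : Rounds f l E → i < j → j < k → ¬ ((i , j) ∈ E × (j , k) ∈ E)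
Rounds-no-path (round {es = es} u sw rs) i<j j<k (ij , jk) with ∈-++⁻ es ij | ∈-++⁻ es jk
... | inj₁ ij∈es | inj₁ jk∈es
  with refl , _ ← Swaps-sound sw ij∈es | refl , _ ← Swaps-sound sw jk∈es =
  <-irrefl refl j<k
... | inj₁ ij∈es | inj₂ jk∈E with refl , _ ← Swaps-sound sw ij∈es =
  contradiction (Rounds-target-≤ rs jk∈E) (<⇒≱ (<-trans (n<1+n _) j<k))
... | inj₂ ij∈E | inj₁ jk∈es = Rounds-LRMax-not-target rs (Swaps-source-LRMax u sw jk∈es) ij∈E
... | inj₂ ij∈E | inj₂ jk∈E = Rounds-no-path rs i<j j<k (ij∈E , jk∈E)

Rounds-B1 : Rounds f l E → B1 E
Rounds-B1 (round {es = es} u sw rs) i j k l′ i<j j<k k<l′ ik jl′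
  with ∈-++⁻ es ik | ∈-++⁻ es jl′
... | inj₁ ik∈es | inj₁ jl′∈es
  with refl , _ ← Swaps-sound sw ik∈es | refl , _ ← Swaps-sound sw jl′∈es =
  contradiction k<l′ (<-irrefl refl)
... | inj₁ ik∈es | inj₂ jl′∈E with refl , _ ← Swaps-sound sw ik∈es =
  contradiction (Rounds-target-≤ rs jl′∈E) (<⇒≱ (<-trans (n<1+n _) k<l′))
... | inj₂ ik∈E | inj₁ jl′∈es =
  ∈-++⁺ʳ es (Rounds-LRMax-B1 rs (Swaps-source-LRMax u sw jl′∈es) ik∈E i<j j<k)
... | inj₂ ik∈E | inj₂ jl′∈E = ∈-++⁺ʳ es (Rounds-B1 rs i j k l′ i<j j<k k<l′ ik∈E jl′∈E)

oneLine-unique : (π : Permutation′ n) → Unique (oneLine π)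
oneLine-unique π = Unique.tabulate⁺ (Injection.injective (↔⇒↣ π) ∘ toℕ-injective ∘ suc-injective)

oneLine-bounded : (π : Permutation′ n) → All (_≤ n) (oneLine π)
oneLine-bounded π = All.tabulate⁺ (λ i → toℕ<n (π ⟨$⟩ʳ i))

lemma2p7 : ∀ (n : ℕ) (π : Permutation′ n) → InNet n (Nπ n π)
lemma2p7 n π = record
  { network = record
    { edges-ok = λ _ _ → Rounds-edge-bounds procedure
    ; no-path  = λ _ _ _ → Rounds-no-path procedure
    }
  ; b1 = Rounds-B1 procedure
  }
  where
  procedure : Rounds n (oneLine π) (Nπ n π)
  procedure = rounds n (oneLine π) (length-tabulate _) (oneLine-unique π) (oneLine-bounded π)
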